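{- Let $d$ be a column-strict domino plane partition and let $(c_0,c_1)=\Phi(d)$. Then: (i) all rows of $d$ have even length if and only if $\mathrm{sh}(c_0)\subseteq\mathrm{sh}(c_1)$ and $\mathrm{sh}(c_1)\setminus\mathrm{sh}(c_0)$ is a horizontal strip; (ii) all columns of $d$ have even length if and only if $\mathrm{sh}(c_1)\subseteq\mathrm{sh}(c_0)$ and $\mathrm{sh}(c_0)\setminus\mathrm{sh}(c_1)$ is a vertical strip; (iii) all rows and all columns of $d$ have even length if and only if $\mathrm{sh}(c_0)=\mathrm{sh}(c_1)$.
   Context: A column-strict domino plane partition $d$ of shape $\mathrm{sh}(d)$ is a tiling of a Young diagram by dominoes ($1\times2$ or $2\times1$), each labelled with a positive integer, weakly decreasing along rows and strictly decreasing down columns. $2$-quotient of a partition $\lambda$: write $\lambda=(\lambda_1,\dots,\lambda_{2p})$ (padding with a zero if needed), $\ell_i=\lambda_i+2p-i$; the even $\ell_i$ are $2k^{(0)}_1>\dots>2k^{(0)}_a$, the odd ones $2k^{(1)}_1+1>\dots>2k^{(1)}_b+1$; $\lambda^{(0)}=(k^{(0)}_1-a+1,\dots,k^{(0)}_a)$, $\lambda^{(1)}=(k^{(1)}_1-b+1,\dots,k^{(1)}_b)$. $\Phi(d)=(c_0,c_1)$ is the Stanton–White map: for $k=0,1$, $c_k$ is the column-strict plane partition such that for every $s\geq1$ the shape of the entries $\geq s$ of $c_k$ is the $k$-th component of the $2$-quotient of the shape of the entries $\geq s$ of $d$ (equivalently: along each content-diagonal, the labels of dominoes whose upper-right cell lies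 on that diagonal and whose diagonal has parity $k$ are turned into single cells and slid down the diagonal). In particular $(\mathrm{sh}(c_0),\mathrm{sh}(c_1))$ is the $2$-quotient of $\mathrm{sh}(d)$. -}

module Defs where

open import Data.Nat using (ℕ; zero; suc; _+_; _∸_; _≤_; _<_; _≤?_; _<?_; _⊔_; _%_; ⌊_/2⌋)
open import Data.Nat.Divisibility using (_∣_)
import Data.Bool as Bool
import Data.Bool
import Data.Nat
open import Data.Bool using (Bool; true; false; if_then_else_)
open import Data.List using (List; []; _∷_; length; map; filter; upTo; foldr; zip; _++_; concatMap)
open import Data.List.Relation.Unary.All using (All)
open import Data.List.Relation.Unary.Linked using (Linked)
open import Data.Product using (_×_; _,_; proj₁; proj₂)
open import Data.Sum using (_⊎_)
open import Relation.Binary.PropositionalEquality using (_≡_; _≢_)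
open import Relation.Nullary using (¬_)

-- Partitions and Young diagrams (English convention, 0-based indices)

-- A partition is a weakly decreasing list of natural numbers
-- (trailing zeros allowed; they do not change the diagram).
record Partition : Set where
  constructor mkPartition
  field
    parts      : List ℕ
    decreasing : Linked (λ a b → b ≤ a) parts
open Partition public

at : List ℕ → ℕ → ℕ
at []       _       = 0
at (x ∷ _)  zero    = x
at (_ ∷ xs) (suc i) = at xs i

Cell : Set
Cell = ℕ × ℕ     -- (row , column)

_∈D_ : Cell → List ℕ → Set
(i , j) ∈D la = j < at la i

_⊆D_ : List ℕ → List ℕ → Set
ν ⊆D μ = ∀ c → c ∈D ν → c ∈D μ

_≐D_ : List ℕ → List ℕ → Set
ν ≐D μ = (ν ⊆D μ) × (μ ⊆D ν)

HorizontalStrip : List ℕ → List ℕ → Set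
HorizontalStrip μ ν = ∀ i i' j → (i , j) ∈D μ → ¬ ((i , j) ∈D ν)
                              → (i' , j) ∈D μ → ¬ ((i' , j) ∈D ν) → i ≡ i'

VerticalStrip : List ℕ → List ℕ → Set
VerticalStrip μ ν = ∀ i j j' → (i , j) ∈D μ → ¬ ((i , j) ∈D ν)
                             → (i , j') ∈D μ → ¬ ((i , j') ∈D ν) → j ≡ j'

colLen : List ℕ → ℕ → ℕ
colLen la j = length (filter (λ x → j <? x) la)

isEven : ℕ → Bool
isEven zero          = true
isEven (suc zero)    = false
isEven (suc (suc n)) = isEven n

pad : List ℕ → List ℕ
pad la = if isEven (length la) then la else la ++ (0 ∷ [])

-- ℓ_i = λ_i + 2p - i  (i = 1..2p), here with 0-based index i : ℓ = λ_i + (2p - 1 - i)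
betas : List ℕ → List ℕ
betas la = map (λ p → proj₁ p + (length (pad la) ∸ suc (proj₂ p))) (zip (pad la) (upTo (length (pad la))))

-- the k^{(0)}'s (from even ℓ_i) resp. k^{(1)}'s (from odd ℓ_i), in decreasing order
ks0 ks1 : List ℕ → List ℕ
ks0 la = map ⌊_/2⌋ (filter (λ x → isEven x Bool.≟ true)  (betas la))
ks1 la = map ⌊_/2⌋ (filter (λ x → isEven x Bool.≟ false) (betas la))

-- (k_1 - a + 1, ..., k_a - a + a), written with 0-based m as (k_m + (m+1)) ∸ a
fromKs : List ℕ → List ℕ
fromKs ks = map (λ p → (proj₁ p + suc (proj₂ p)) ∸ length ks) (zip ks (upTo (length ks)))

quot0 quot1 : List ℕ → List ℕ
quot0 la = fromKs (ks0 la)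
quot1 la = fromKs (ks1 la)

Adjacent : Cell → Cell → Set
Adjacent (i , j) (i' , j') = (i ≡ i' × (suc j ≡ j' ⊎ j ≡ suc j'))
                           ⊎ (j ≡ j' × (suc i ≡ i' ⊎ i ≡ suc i'))

-- A domino tiling of the diagram is encoded by the "partner" map sending
-- each cell to the other cell of its domino (an adjacent-cell involution
-- of the diagram); the label of a cell is the label of its domino.
record DominoPP : Set where
  field
    shape       : Partition
    partner     : Cell → Cell
    label       : Cell → ℕ
    partner-in  : ∀ c → c ∈D parts shape → partner c ∈D parts shape
    partner-inv : ∀ c → c ∈D parts shape → partner (partner c) ≡ c
    partner-adj : ∀ c → c ∈D parts shape → Adjacent c (partner c)
    label-dom   : ∀ c → c ∈D parts shape → label (partner c) ≡ label c
    label-pos   : ∀ c → c ∈D parts shape → 1 ≤ label c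
    row-weak    : ∀ i j → (i , suc j) ∈D parts shape → label (i , suc j) ≤ label (i , j)
    col-strict  : ∀ i j → (suc i , j) ∈D parts shape → partner (i , j) ≢ (suc i , j)
                  → label (suc i , j) < label (i , j)
open DominoPP public

shD : DominoPP → List ℕ
shD d = parts (shape d)

shapeGE : DominoPP → ℕ → List ℕ
shapeGE d s = map (λ p → length (filter (λ j → s ≤? label d (proj₂ p , j)) (upTo (proj₁ p))))
                  (zip (shD d) (upTo (length (shD d))))

cellsOf : List ℕ → List Cell
cellsOf la = concatMap (λ p → map (λ j → (proj₂ p , j)) (upTo (proj₁ p))) (zip la (upTo (length la)))

maxLabel : DominoPP → ℕ
maxLabel d = foldr (λ c m → label d c ⊔ m) 0 (cellsOf (shD d))

record Filling : Set where
  constructor mkFilling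
  field
    fshape : List ℕ
    entry  : Cell → ℕ
open Filling public

sh : Filling → List ℕ
sh = fshape

inDB : Cell → List ℕ → Bool
inDB (i , j) la = Data.Bool.not (at la i Data.Nat.≤ᵇ j)

largestS : (List ℕ → List ℕ) → DominoPP → Cell → ℕ
largestS q d c = foldr (λ s m → if inDB c (q (shapeGE d (suc s))) then suc s ⊔ m else m) 0
                       (upTo (maxLabel d))

-- The Stanton–White map Φ(d) = (c₀ , c₁): the entries ≥ s of c_k form the
-- k-th component of the 2-quotient of the shape of the entries ≥ s of d.
Φ : DominoPP → Filling × Filling
Φ d = mkFilling (quot0 (shD d)) (largestS quot0 d)
    , mkFilling (quot1 (shD d)) (largestS quot1 d)

AllRowsEven : DominoPP → Set
AllRowsEven d = All (2 ∣_) (shD d)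

AllColsEven : DominoPP → Set
AllColsEven d = ∀ j → 2 ∣ colLen (shD d) j

-- Pad λ to 2p rows and encode it by its β-numbers β_i = λ_i + 2p − 1 − i. The two components
-- of the 2-quotient are the partitions whose β-numbers are the halves ⌊β/2⌋ of the even,
-- respectively odd, β_i, so every relation in the statement becomes a relation between these two
-- lists of halves. λ⁽⁰⁾ ⊆ λ⁽¹⁾ with a horizontal strip as difference says that the halves
-- interlace, o₁ ≥ e₁ > o₂ ≥ e₂ > ⋯, i.e. that the β-numbers, read from the largest, are odd, even,
-- odd, …; that is exactly what all rows of λ being even means. λ⁽¹⁾ ⊆ λ⁽⁰⁾ with a vertical strip as
-- difference says o_k ≤ e_k ≤ o_k + 1, i.e. that the β-numbers come in pairs of consecutive
-- integers, i.e. that the rows of λ come in equal pairs, i.e. that all columns are even.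
-- Both translations need as many even as odd β-numbers, and this is where the tiling enters:
-- colour the diagram like a chessboard; every domino covers one cell of each colour, and counting
-- two rows at a time gives #even β − #odd β = 2 (#white − #black) = 0.

module Submission where

open import Data.Bool using (Bool; true; false; not; if_then_else_)
import Data.Bool as Bool
open import Data.Bool.Properties using (not-involutive; not-¬)
open import Data.List using (List; []; _∷_; length; map; filter; zip; applyUpTo; downFrom; _++_)
open import Data.List.Membership.Propositional using (_∈_)
open import Data.List.Membership.Propositional.Properties
  using (∈-∃++; ∈-++⁻; ∈-++⁺ˡ; ∈-++⁺ʳ; ∈-map⁺; ∈-map⁻; ∈-filter⁺; ∈-filter⁻; ∈-downFrom⁺; ∈-downFrom⁻)
open import Data.List.Properties using (filter-accept; filter-reject; filter-none; length-++; length-map)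
open import Data.List.Relation.Binary.Pointwise using (Pointwise; []; _∷_)
open import Data.List.Relation.Unary.All as All using (All; []; _∷_)
import Data.List.Relation.Unary.All.Properties as All
open import Data.List.Relation.Unary.AllPairs using (AllPairs; []; _∷_)
open import Data.List.Relation.Unary.Any using (here; there)
open import Data.List.Relation.Unary.Linked using (Linked; []; [-]; _∷_)
open import Data.List.Relation.Unary.Linked.Properties using (Linked⇒AllPairs)
open import Data.List.Relation.Unary.Unique.Propositional using (Unique)
import Data.List.Relation.Unary.Unique.Propositional.Properties as Unique
open import Data.Nat
  using (ℕ; zero; suc; pred; _+_; _*_; _∸_; _≤_; _<_; _≥_; _>_; z≤n; s≤s; s≤s⁻¹; _<?_; ⌊_/2⌋; ⌈_/2⌉)
open import Data.Nat.Divisibility using (_∣_; divides; ∣-refl; ∣1⇒≡1; ∣m∣n⇒∣m+n; ∣m+n∣m⇒∣n)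
open import Data.Nat.Properties
open import Data.Nat.Tactic.RingSolver using (solve-∀)
open import Data.Product using (_×_; _,_; proj₁; proj₂; map₁)
open import Data.Product.Function.NonDependent.Propositional using (_×-⇔_)
open import Data.Sum using (inj₁; inj₂)
open import Data.Unit using (⊤; tt)
open import Function using (_∘_)
open import Function.Bundles using (_⇔_; mk⇔; Equivalence)
open import Function.Construct.Symmetry using (⇔-sym)
import Function.Related.Propositional as Related
open import Relation.Binary.Definitions using (tri<; tri≈; tri>)
open import Relation.Binary.PropositionalEquality
open import Relation.Nullary using (¬_; Dec; contradiction; yes; no)

open import Defs

isEven-suc : ∀ n → isEven (suc n) ≡ not (isEven n)
isEven-suc zero          = refl
isEven-suc (suc zero)    = refl
isEven-suc (suc (suc n)) = isEven-suc n

even⇒⌊n/2⌋+⌊n/2⌋≡n : ∀ n → isEven n ≡ true → ⌊ n /2⌋ + ⌊ n /2⌋ ≡ n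
even⇒⌊n/2⌋+⌊n/2⌋≡n zero          _ = refl
even⇒⌊n/2⌋+⌊n/2⌋≡n (suc (suc n)) e =
  cong suc (trans (+-suc ⌊ n /2⌋ ⌊ n /2⌋) (cong suc (even⇒⌊n/2⌋+⌊n/2⌋≡n n e)))

odd⇒1+⌊n/2⌋+⌊n/2⌋≡n : ∀ n → isEven n ≡ false → suc (⌊ n /2⌋ + ⌊ n /2⌋) ≡ n
odd⇒1+⌊n/2⌋+⌊n/2⌋≡n (suc zero)    _ = refl
odd⇒1+⌊n/2⌋+⌊n/2⌋≡n (suc (suc n)) o =
  cong suc (trans (cong suc (+-suc ⌊ n /2⌋ ⌊ n /2⌋)) (cong suc (odd⇒1+⌊n/2⌋+⌊n/2⌋≡n n o)))

even⇒⌊1+n/2⌋≡⌊n/2⌋ : ∀ n → isEven n ≡ true → ⌊ suc n /2⌋ ≡ ⌊ n /2⌋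
even⇒⌊1+n/2⌋≡⌊n/2⌋ zero          _ = refl
even⇒⌊1+n/2⌋≡⌊n/2⌋ (suc (suc n)) e = cong suc (even⇒⌊1+n/2⌋≡⌊n/2⌋ n e)

odd⇒⌊1+n/2⌋≡1+⌊n/2⌋ : ∀ n → isEven n ≡ false → ⌊ suc n /2⌋ ≡ suc ⌊ n /2⌋
odd⇒⌊1+n/2⌋≡1+⌊n/2⌋ (suc zero)    _ = refl
odd⇒⌊1+n/2⌋≡1+⌊n/2⌋ (suc (suc n)) o = cong suc (odd⇒⌊1+n/2⌋≡1+⌊n/2⌋ n o)

isEven⇔2∣ : ∀ n → isEven n ≡ true ⇔ 2 ∣ n
isEven⇔2∣ n = mk⇔ to from
  where
  to : isEven n ≡ true → 2 ∣ n
  to even = divides ⌊ n /2⌋ (begin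
    n                 ≡⟨ sym (even⇒⌊n/2⌋+⌊n/2⌋≡n n even) ⟩
    ⌊ n /2⌋ + ⌊ n /2⌋ ≡⟨ cong (⌊ n /2⌋ +_) (sym (+-identityʳ ⌊ n /2⌋)) ⟩
    2 * ⌊ n /2⌋       ≡⟨ *-comm 2 ⌊ n /2⌋ ⟩
    ⌊ n /2⌋ * 2       ∎)
    where open ≡-Reasoning
  isEven-*2 : ∀ q → isEven (q * 2) ≡ true
  isEven-*2 zero    = refl
  isEven-*2 (suc q) = isEven-*2 q
  from : 2 ∣ n → isEven n ≡ true
  from (divides q refl) = isEven-*2 q

-- β-numbers and the 2-quotient

mapWithRest : (ℕ → ℕ → ℕ) → List ℕ → List ℕ
mapWithRest f []       = []
mapWithRest f (x ∷ xs) = f x (length xs) ∷ mapWithRest f xs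

map-zip-applyUpTo : ∀ (g : ℕ × ℕ → ℕ) (f : ℕ → ℕ → ℕ) (ix : ℕ → ℕ) xs →
  (∀ x i → i < length xs → g (x , ix i) ≡ f x (length xs ∸ suc i)) →
  map g (zip xs (applyUpTo ix (length xs))) ≡ mapWithRest f xs
map-zip-applyUpTo g f ix []       _ = refl
map-zip-applyUpTo g f ix (x ∷ xs) h =
  cong₂ _∷_ (h x 0 (s≤s z≤n)) (map-zip-applyUpTo g f (ix ∘ suc) xs (λ y i i< → h y (suc i) (s≤s i<)))

betaNumbers fromBetas : List ℕ → List ℕ
betaNumbers = mapWithRest _+_
fromBetas   = mapWithRest _∸_

isEven≟ : ∀ b n → Dec (isEven n ≡ b)
isEven≟ b n = isEven n Bool.≟ b

evenHalves oddHalves : List ℕ → List ℕ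
evenHalves xs = map ⌊_/2⌋ (filter (isEven≟ true) xs)
oddHalves  xs = map ⌊_/2⌋ (filter (isEven≟ false) xs)

betas≡betaNumbers∘pad : ∀ la → betas la ≡ betaNumbers (pad la)
betas≡betaNumbers∘pad la = map-zip-applyUpTo _ _+_ (λ i → i) (pad la) (λ _ _ _ → refl)

fromKs≡fromBetas : ∀ ks → fromKs ks ≡ fromBetas ks
fromKs≡fromBetas ks = map-zip-applyUpTo _ _∸_ (λ i → i) ks shift
  where
  shift : ∀ x i → i < length ks → (x + suc i) ∸ length ks ≡ x ∸ (length ks ∸ suc i)
  shift x i i< = begin
    (x + suc i) ∸ length ks                     ≡⟨ cong ((x + suc i) ∸_) (sym (m+[n∸m]≡n i<)) ⟩
    (x + suc i) ∸ (suc i + (length ks ∸ suc i)) ≡⟨ cong (_∸ (suc i + (length ks ∸ suc i))) (+-comm x (suc i)) ⟩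
    (suc i + x) ∸ (suc i + (length ks ∸ suc i)) ≡⟨ [m+n]∸[m+o]≡n∸o (suc i) x (length ks ∸ suc i) ⟩
    x ∸ (length ks ∸ suc i)                     ∎
    where open ≡-Reasoning

quot0≡ : ∀ la → quot0 la ≡ fromBetas (evenHalves (betaNumbers (pad la)))
quot0≡ la = trans (fromKs≡fromBetas (ks0 la)) (cong (fromBetas ∘ evenHalves) (betas≡betaNumbers∘pad la))

quot1≡ : ∀ la → quot1 la ≡ fromBetas (oddHalves (betaNumbers (pad la)))
quot1≡ la = trans (fromKs≡fromBetas (ks1 la)) (cong (fromBetas ∘ oddHalves) (betas≡betaNumbers∘pad la))

at-antitone : ∀ {la} → Linked _≥_ la → ∀ i → at la (suc i) ≤ at la i
at-antitone []       _       = z≤n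
at-antitone [-]      _       = z≤n
at-antitone (p ∷ _)  zero    = p
at-antitone (_ ∷ ps) (suc i) = at-antitone ps i

at-antitone-≤ : ∀ {la} → Linked _≥_ la → ∀ {i i'} → i ≤ i' → at la i' ≤ at la i
at-antitone-≤ ps {i' = zero}  z≤n = ≤-refl
at-antitone-≤ ps {i' = suc k} i≤ with m≤n⇒m<n∨m≡n i≤
... | inj₂ refl  = ≤-refl
... | inj₁ i<1+k = ≤-trans (at-antitone ps k) (at-antitone-≤ ps (s≤s⁻¹ i<1+k))

⊆D⇔at≤ : ∀ ν μ → ν ⊆D μ ⇔ (∀ i → at ν i ≤ at μ i)
⊆D⇔at≤ ν μ = mk⇔ (λ ν⊆μ i → ≮⇒≥ (λ lt → n≮n _ (ν⊆μ (i , at μ i) lt)))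
                 (λ ν≤μ (i , j) j<ν → <-≤-trans j<ν (ν≤μ i))

HorizontalStrip⇔ : ∀ {μ ν} → Linked _≥_ μ → Linked _≥_ ν →
  HorizontalStrip μ ν ⇔ (∀ i → at μ (suc i) ≤ at ν i)
HorizontalStrip⇔ {μ} {ν} μ↓ ν↓ = mk⇔ to from
  where
  to : HorizontalStrip μ ν → ∀ i → at μ (suc i) ≤ at ν i
  to hs i = ≮⇒≥ λ ν<μ → 1+n≢n (sym (hs i (suc i) (at ν i)
    (<-≤-trans ν<μ (at-antitone μ↓ i)) (n≮n _)
    ν<μ (λ lt → n≮n _ (<-≤-trans lt (at-antitone ν↓ i)))))
  below : (∀ i → at μ (suc i) ≤ at ν i) →
          ∀ {i i' j} → j < at μ i' → i < i' → ¬ j < at ν i → j < j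
  below μ≤ν j<μi' i<i' j≮νi = <-≤-trans j<μi'
    (≤-trans (at-antitone-≤ μ↓ i<i') (≤-trans (μ≤ν _) (≮⇒≥ j≮νi)))
  from : (∀ i → at μ (suc i) ≤ at ν i) → HorizontalStrip μ ν
  from μ≤ν i i' j j<μi j≮νi j<μi' j≮νi' with <-cmp i i'
  ... | tri≈ _ i≡i' _ = i≡i'
  ... | tri< i<i' _ _ = contradiction (below μ≤ν j<μi' i<i' j≮νi) (n≮n j)
  ... | tri> _ _ i>i' = contradiction (below μ≤ν j<μi i>i' j≮νi') (n≮n j)

VerticalStrip⇔ : ∀ μ ν → VerticalStrip μ ν ⇔ (∀ i → at μ i ≤ suc (at ν i))
VerticalStrip⇔ μ ν = mk⇔ to from
  where
  to : VerticalStrip μ ν → ∀ i → at μ i ≤ suc (at ν i)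
  to vs i = ≮⇒≥ λ 1+ν<μ → 1+n≢n (sym (vs i (at ν i) (suc (at ν i))
    (<-trans (n<1+n _) 1+ν<μ) (n≮n _) 1+ν<μ (λ lt → n≮n _ (<-trans lt (n<1+n _)))))
  column : ∀ {i j} → at μ i ≤ suc (at ν i) → j < at μ i → ¬ j < at ν i → j ≡ at ν i
  column μ≤1+ν j<μ j≮ν = ≤-antisym (s≤s⁻¹ (≤-trans j<μ μ≤1+ν)) (≮⇒≥ j≮ν)
  from : (∀ i → at μ i ≤ suc (at ν i)) → VerticalStrip μ ν
  from μ≤1+ν i j j' j<μ j≮ν j'<μ j'≮ν =
    trans (column (μ≤1+ν i) j<μ j≮ν) (sym (column (μ≤1+ν i) j'<μ j'≮ν))

length≤head : ∀ {x xs} → AllPairs _>_ (x ∷ xs) → length xs ≤ x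
length≤head {xs = []}     _                      = z≤n
length≤head {xs = y ∷ ys} ((y<x ∷ _) ∷ y∷ys↓) = ≤-trans (s≤s (length≤head y∷ys↓)) y<x

fromBetas-antitone : ∀ {xs} → AllPairs _>_ xs → Linked _≥_ (fromBetas xs)
fromBetas-antitone {[]}         _                  = []
fromBetas-antitone {_ ∷ []}     _                  = [-]
fromBetas-antitone {_ ∷ _ ∷ ys} ((y<x ∷ _) ∷ ys↓) = ∸-monoˡ-≤ (suc (length ys)) y<x ∷ fromBetas-antitone ys↓

∸-≤-∸⇔ : ∀ {m n a b} → m ≡ n → m ≤ a → n ≤ b → (a ∸ m ≤ b ∸ n) ⇔ (a ≤ b)
∸-≤-∸⇔ {m} refl m≤a m≤b = mk⇔
  (λ le → subst₂ _≤_ (m∸n+n≡m m≤a) (m∸n+n≡m m≤b) (+-monoˡ-≤ m le))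
  (∸-monoˡ-≤ m)

data Interlaced : List ℕ → List ℕ → Set where
  []  : Interlaced [] []
  _∷_ : ∀ {o e os es} → e ≤ o × All (_< e) os → Interlaced os es → Interlaced (o ∷ os) (e ∷ es)

WithinOne : ℕ → ℕ → Set
WithinOne o e = o ≤ e × e ≤ suc o

fromBetas-head≤⇔ : ∀ {e m xs} → AllPairs _>_ xs → length xs ≡ m → m ≤ e →
  (at (fromBetas xs) 0 ≤ e ∸ m) ⇔ All (_< e) xs
fromBetas-head≤⇔ {xs = []}     _ _ _ = mk⇔ (λ _ → []) (λ _ → z≤n)
fromBetas-head≤⇔ {e} {xs = x ∷ xs} x∷xs↓@(xs<x ∷ _) refl m≤e = mk⇔
  (λ le → let x<e = Equivalence.to x<e⇔ le in x<e ∷ All.map (λ y<x → <-trans y<x x<e) xs<x)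
  (λ { (x<e ∷ _) → Equivalence.from x<e⇔ x<e })
  where
  x<e⇔ : (x ∸ length xs ≤ e ∸ suc (length xs)) ⇔ x < e
  x<e⇔ = ∸-≤-∸⇔ refl (s≤s (length≤head x∷xs↓)) m≤e

fromBetas-interlaced⇔ : ∀ {O E} → AllPairs _>_ O → AllPairs _>_ E → length O ≡ length E →
  ((∀ i → at (fromBetas E) i ≤ at (fromBetas O) i) ×
   (∀ i → at (fromBetas O) (suc i) ≤ at (fromBetas E) i)) ⇔ Interlaced O E
fromBetas-interlaced⇔ {[]}     {[]}     _ _ _ = mk⇔ (λ _ → []) (λ _ → (λ _ → z≤n) , (λ _ → z≤n))
fromBetas-interlaced⇔ {o ∷ os} {e ∷ es} O↓@(_ ∷ os↓) E↓@(_ ∷ es↓) eq = mk⇔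
  (λ (E≤O , O≤E) → (Equivalence.to e≤o⇔ (E≤O 0) , Equivalence.to os<e⇔ (O≤E 0))
                 ∷ Equivalence.to ih ((λ i → E≤O (suc i)) , (λ i → O≤E (suc i))))
  (λ { ((e≤o , os<e) ∷ rest) →
         (λ { zero → Equivalence.from e≤o⇔ e≤o   ; (suc i) → proj₁ (Equivalence.from ih rest) i })
       , (λ { zero → Equivalence.from os<e⇔ os<e ; (suc i) → proj₂ (Equivalence.from ih rest) i }) })
  where
  e≤o⇔ : (e ∸ length es ≤ o ∸ length os) ⇔ e ≤ o
  e≤o⇔ = ∸-≤-∸⇔ (suc-injective (sym eq)) (length≤head E↓) (length≤head O↓)
  os<e⇔ : (at (fromBetas os) 0 ≤ e ∸ length es) ⇔ All (_< e) os
  os<e⇔ = fromBetas-head≤⇔ os↓ (suc-injective eq) (length≤head E↓)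
  ih = fromBetas-interlaced⇔ os↓ es↓ (suc-injective eq)

fromBetas-withinOne⇔ : ∀ {O E} → AllPairs _>_ O → AllPairs _>_ E → length O ≡ length E →
  ((∀ i → at (fromBetas O) i ≤ at (fromBetas E) i) ×
   (∀ i → at (fromBetas E) i ≤ suc (at (fromBetas O) i))) ⇔ Pointwise WithinOne O E
fromBetas-withinOne⇔ {[]}     {[]}     _ _ _ = mk⇔ (λ _ → []) (λ _ → (λ _ → z≤n) , (λ _ → z≤n))
fromBetas-withinOne⇔ {o ∷ os} {e ∷ es} O↓@(_ ∷ os↓) E↓@(_ ∷ es↓) eq = mk⇔
  (λ (O≤E , E≤1+O) → (Equivalence.to o≤e⇔ (O≤E 0) , Equivalence.to e≤1+o⇔ (E≤1+O 0))
                   ∷ Equivalence.to ih ((λ i → O≤E (suc i)) , (λ i → E≤1+O (suc i))))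
  (λ { ((o≤e , e≤1+o) ∷ rest) →
         (λ { zero → Equivalence.from o≤e⇔ o≤e ; (suc i) → proj₁ (Equivalence.from ih rest) i })
       , (λ { zero → Equivalence.from e≤1+o⇔ e≤1+o ; (suc i) → proj₂ (Equivalence.from ih rest) i }) })
  where
  n≤o : length os ≤ o
  n≤o = length≤head O↓
  o≤e⇔ : (o ∸ length os ≤ e ∸ length es) ⇔ o ≤ e
  o≤e⇔ = ∸-≤-∸⇔ (suc-injective eq) n≤o (length≤head E↓)
  e≤1+o⇔ : (e ∸ length es ≤ suc (o ∸ length os)) ⇔ e ≤ suc o
  e≤1+o⇔ = subst (λ k → (e ∸ length es ≤ k) ⇔ e ≤ suc o) (+-∸-assoc 1 n≤o)
                 (∸-≤-∸⇔ (suc-injective (sym eq)) (length≤head E↓) (≤-trans n≤o (n≤1+n o)))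
  ih = fromBetas-withinOne⇔ os↓ es↓ (suc-injective eq)

betaNumbers-strict : ∀ {P} → Linked _≥_ P → Linked _>_ (betaNumbers P)
betaNumbers-strict {[]}           []        = []
betaNumbers-strict {_ ∷ []}       [-]       = [-]
betaNumbers-strict {x ∷ y ∷ ys} (y≤x ∷ P↓) =
  subst (suc (y + length ys) ≤_) (sym (+-suc x (length ys))) (s≤s (+-monoˡ-≤ (length ys) y≤x))
  ∷ betaNumbers-strict P↓

m+m<n+n⇒m<n : ∀ {m n} → m + m < n + n → m < n
m+m<n+n⇒m<n m+m<n+n = ≰⇒> λ n≤m → <⇒≱ m+m<n+n (+-mono-≤ n≤m n≤m)

m+m≤n+n⇒m≤n : ∀ {m n} → m + m ≤ n + n → m ≤ n
m+m≤n+n⇒m≤n m+m≤n+n = ≮⇒≥ λ n<m → <⇒≱ (+-mono-< n<m n<m) m+m≤n+n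

All-evenHalves : ∀ {P : ℕ → Set} xs → All P xs → All (λ k → P (k + k)) (evenHalves xs)
All-evenHalves []       []       = []
All-evenHalves {P} (x ∷ xs) (px ∷ pxs) with isEven x in parity
... | true  = subst P (sym (even⇒⌊n/2⌋+⌊n/2⌋≡n x parity)) px ∷ All-evenHalves xs pxs
... | false = All-evenHalves xs pxs

All-oddHalves : ∀ {P : ℕ → Set} xs → All P xs → All (λ k → P (suc (k + k))) (oddHalves xs)
All-oddHalves []       []       = []
All-oddHalves {P} (x ∷ xs) (px ∷ pxs) with isEven x in parity
... | true  = All-oddHalves xs pxs
... | false = subst P (sym (odd⇒1+⌊n/2⌋+⌊n/2⌋≡n x parity)) px ∷ All-oddHalves xs pxs

evenHalves-strict : ∀ {xs} → AllPairs _>_ xs → AllPairs _>_ (evenHalves xs)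
evenHalves-strict {[]}     []              = []
evenHalves-strict {x ∷ xs} (xs<x ∷ xs↓) with isEven x in parity
... | true  = All.map (λ k+k<x → m+m<n+n⇒m<n (subst (_ <_) (sym (even⇒⌊n/2⌋+⌊n/2⌋≡n x parity)) k+k<x))
                      (All-evenHalves xs xs<x)
            ∷ evenHalves-strict xs↓
... | false = evenHalves-strict xs↓

oddHalves-strict : ∀ {xs} → AllPairs _>_ xs → AllPairs _>_ (oddHalves xs)
oddHalves-strict {[]}     []              = []
oddHalves-strict {x ∷ xs} (xs<x ∷ xs↓) with isEven x in parity
... | true  = oddHalves-strict xs↓
... | false = All.map (λ 1+k+k<x → m+m<n+n⇒m<n (s≤s⁻¹ (subst (_ <_) (sym (odd⇒1+⌊n/2⌋+⌊n/2⌋≡n x parity)) 1+k+k<x)))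
                      (All-oddHalves xs xs<x)
            ∷ oddHalves-strict xs↓

Alternating : Bool → List ℕ → Set
Alternating b []       = ⊤
Alternating b (x ∷ xs) = isEven x ≡ b × Alternating (not b) xs

no-even-first : ∀ {x k os es} → All (λ o → suc (o + o) < x) os → k + k ≡ x → ¬ Interlaced os (k ∷ es)
no-even-first (1+o+o<x ∷ _) refl ((k≤o , _) ∷ _) = <⇒≱ (m+m<n+n⇒m<n (<-trans (n<1+n _) 1+o+o<x)) k≤o

no-odd-second : ∀ {y h k os es} → All (λ e → e + e < y) es → suc (k + k) ≡ y → ¬ Interlaced (h ∷ k ∷ os) es
no-odd-second (e+e<y ∷ _) refl ((_ , k<e ∷ _) ∷ _) = <⇒≱ k<e (m+m≤n+n⇒m≤n (s≤s⁻¹ e+e<y))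

interlaced⇒alternating : ∀ {B} → AllPairs _>_ B → Interlaced (oddHalves B) (evenHalves B) → Alternating false B
interlaced⇒alternating-after-odd : ∀ {h B} → AllPairs _>_ B → Interlaced (h ∷ oddHalves B) (evenHalves B) →
  Alternating true B

interlaced⇒alternating {[]}    _             _ = tt
interlaced⇒alternating {x ∷ B} (B<x ∷ B↓) I with isEven x in parity
... | true  = contradiction I (no-even-first (All-oddHalves B B<x) (even⇒⌊n/2⌋+⌊n/2⌋≡n x parity))
... | false = refl , interlaced⇒alternating-after-odd B↓ I

interlaced⇒alternating-after-odd {B = []}    _          ()
interlaced⇒alternating-after-odd {B = y ∷ B} (B<y ∷ B↓) I with isEven y in parity
interlaced⇒alternating-after-odd (_ ∷ B↓) (_ ∷ I) | true = refl , interlaced⇒alternating B↓ I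
interlaced⇒alternating-after-odd {B = y ∷ B} (B<y ∷ B↓) I | false =
  contradiction I (no-odd-second (All-evenHalves B B<y) (odd⇒1+⌊n/2⌋+⌊n/2⌋≡n y parity))

alternating⇒interlaced : ∀ {B} → AllPairs _>_ B → length (evenHalves B) ≡ length (oddHalves B) →
  Alternating false B → Interlaced (oddHalves B) (evenHalves B)
alternating⇒interlaced {[]}        _ _ _ = []
alternating⇒interlaced {x ∷ []}    _ balanced (odd , _) with isEven x
alternating⇒interlaced {x ∷ []}    _ _        (() , _) | true
alternating⇒interlaced {x ∷ []}    _ ()       _        | false
alternating⇒interlaced {x ∷ y ∷ B} ((y<x ∷ _) ∷ B<y ∷ B↓) balanced (odd , even , alt)
  with isEven x
... | true = contradiction odd λ ()
... | false with isEven y in parityʸ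
...   | false = contradiction even λ ()
...   | true  = (⌊n/2⌋-mono (<⇒≤ y<x) , All.map below-half (All-oddHalves B B<y))
              ∷ alternating⇒interlaced B↓ (suc-injective balanced) alt
  where
  below-half : ∀ {o} → suc (o + o) < y → o < ⌊ y /2⌋
  below-half {o} 1+o+o<y = m+m<n+n⇒m<n
    (<-trans (n<1+n _) (subst (suc (o + o) <_) (sym (even⇒⌊n/2⌋+⌊n/2⌋≡n y parityʸ)) 1+o+o<y))

alternating⇔interlaced : ∀ {B} → AllPairs _>_ B → length (evenHalves B) ≡ length (oddHalves B) →
  Alternating false B ⇔ Interlaced (oddHalves B) (evenHalves B)
alternating⇔interlaced B↓ balanced = mk⇔ (alternating⇒interlaced B↓ balanced) (interlaced⇒alternating B↓)

data Paired (R : ℕ → ℕ → Set) : List ℕ → Set where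
  []  : Paired R []
  _∷_ : ∀ {x y zs} → R x y → Paired R zs → Paired R (x ∷ y ∷ zs)

no-even-after-even : ∀ {x y h os es} → All (λ o → suc (o + o) < y) os → h + h ≡ x → y < x →
  ¬ Pointwise WithinOne os (h ∷ es)
no-even-after-even {y = y} (1+o+o<y ∷ _) refl y<h+h ((_ , h≤1+o) ∷ _) =
  <⇒≱ y<h+h (≤-trans (+-mono-≤ h≤1+o h≤1+o) (subst (_≤ y) (sym (cong suc (+-suc _ _))) 1+o+o<y))

no-odd-after-odd : ∀ {x y h os es} → All (λ e → e + e < y) es → suc (h + h) ≡ x → y < x →
  ¬ Pointwise WithinOne (h ∷ os) es
no-odd-after-odd (e+e<y ∷ _) refl y<1+h+h ((h≤e , _) ∷ _) =
  <⇒≱ e+e<y (≤-trans (s≤s⁻¹ y<1+h+h) (+-mono-≤ h≤e h≤e))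

even-above-odd⇒≡suc : ∀ {h o x y} → h + h ≡ x → suc (o + o) ≡ y → y < x → h ≤ suc o → x ≡ suc y
even-above-odd⇒≡suc {h} {o} refl refl y<x h≤1+o = begin
  h + h             ≡⟨ cong₂ _+_ h≡1+o h≡1+o ⟩
  suc o + suc o     ≡⟨ cong suc (+-suc o o) ⟩
  suc (suc (o + o)) ∎
  where
  open ≡-Reasoning
  h≡1+o : h ≡ suc o
  h≡1+o = ≤-antisym h≤1+o (m+m<n+n⇒m<n (<-trans (n<1+n _) y<x))

odd-above-even⇒≡suc : ∀ {h k x y} → suc (h + h) ≡ x → k + k ≡ y → y < x → h ≤ k → x ≡ suc y
odd-above-even⇒≡suc {h} {k} refl refl y<x h≤k = cong suc (cong₂ _+_ h≡k h≡k)
  where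
  h≡k : h ≡ k
  h≡k = ≤-antisym h≤k (m+m≤n+n⇒m≤n (s≤s⁻¹ y<x))

withinOne⇒paired : ∀ {B} → AllPairs _>_ B → Pointwise WithinOne (oddHalves B) (evenHalves B) →
  Paired (λ x y → x ≡ suc y) B
withinOne⇒paired {[]}     _ _  = []
withinOne⇒paired {x ∷ []} _ pw with isEven x
... | true  = contradiction pw λ ()
... | false = contradiction pw λ ()
withinOne⇒paired {x ∷ y ∷ r} ((y<x ∷ _) ∷ r<y ∷ r↓) pw with isEven x in parityˣ
... | true with isEven y in parityʸ
...   | true  = contradiction pw (no-even-after-even (All-oddHalves r r<y) (even⇒⌊n/2⌋+⌊n/2⌋≡n x parityˣ) y<x)
withinOne⇒paired {x ∷ y ∷ r} ((y<x ∷ _) ∷ _ ∷ r↓) ((_ , h≤1+o) ∷ pw) | true | false =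
  even-above-odd⇒≡suc (even⇒⌊n/2⌋+⌊n/2⌋≡n x parityˣ) (odd⇒1+⌊n/2⌋+⌊n/2⌋≡n y parityʸ) y<x h≤1+o
  ∷ withinOne⇒paired r↓ pw
withinOne⇒paired {x ∷ y ∷ r} ((y<x ∷ _) ∷ r<y ∷ r↓) pw | false with isEven y in parityʸ
...   | false = contradiction pw (no-odd-after-odd (All-evenHalves r r<y) (odd⇒1+⌊n/2⌋+⌊n/2⌋≡n x parityˣ) y<x)
withinOne⇒paired {x ∷ y ∷ r} ((y<x ∷ _) ∷ _ ∷ r↓) ((h≤k , _) ∷ pw) | false | true =
  odd-above-even⇒≡suc (odd⇒1+⌊n/2⌋+⌊n/2⌋≡n x parityˣ) (even⇒⌊n/2⌋+⌊n/2⌋≡n y parityʸ) y<x h≤k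
  ∷ withinOne⇒paired r↓ pw

paired⇒withinOne : ∀ {B} → Paired (λ x y → x ≡ suc y) B → Pointwise WithinOne (oddHalves B) (evenHalves B)
paired⇒withinOne []                     = []
paired⇒withinOne {suc y ∷ y ∷ r} (refl ∷ paired) rewrite isEven-suc y with isEven y in parity
... | true  rewrite parity | even⇒⌊1+n/2⌋≡⌊n/2⌋ y parity  = (≤-refl , n≤1+n _) ∷ paired⇒withinOne paired
... | false rewrite parity | odd⇒⌊1+n/2⌋≡1+⌊n/2⌋ y parity = (n≤1+n _ , ≤-refl) ∷ paired⇒withinOne paired

withinOne⇔paired : ∀ {B} → AllPairs _>_ B →
  Pointwise WithinOne (oddHalves B) (evenHalves B) ⇔ Paired (λ x y → x ≡ suc y) B
withinOne⇔paired B↓ = mk⇔ (withinOne⇒paired B↓) paired⇒withinOne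

isEven-+-≡⇔ : ∀ m n → (isEven (m + n) ≡ isEven n) ⇔ (isEven m ≡ true)
isEven-+-≡⇔ zero          n = mk⇔ (λ _ → refl) (λ _ → refl)
isEven-+-≡⇔ (suc zero)    n = mk⇔ (λ same → contradiction (trans (sym same) (isEven-suc n)) (not-¬ refl)) λ ()
isEven-+-≡⇔ (suc (suc m)) n = isEven-+-≡⇔ m n

-- isEven (suc (length P)) is the parity of length P − 1, the offset in the first β-number.
rowsEven⇔alternating : ∀ P → All (2 ∣_) P ⇔ Alternating (isEven (suc (length P))) (betaNumbers P)
rowsEven⇔alternating []       = mk⇔ (λ _ → tt) (λ _ → [])
rowsEven⇔alternating (x ∷ xs) = mk⇔
  (λ { (2∣x ∷ xs-even) → Equivalence.from head⇔ 2∣x , Equivalence.to tail⇔ xs-even })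
  (λ { (parity , alt) → Equivalence.to head⇔ parity ∷ Equivalence.from tail⇔ alt })
  where
  t : ℕ
  t = length xs
  head⇔ : (isEven (x + t) ≡ isEven t) ⇔ 2 ∣ x
  head⇔ = mk⇔ (Equivalence.to (isEven⇔2∣ x) ∘ Equivalence.to (isEven-+-≡⇔ x t))
              (Equivalence.from (isEven-+-≡⇔ x t) ∘ Equivalence.from (isEven⇔2∣ x))
  tail⇔ : All (2 ∣_) xs ⇔ Alternating (not (isEven t)) (betaNumbers xs)
  tail⇔ = subst (λ b → All (2 ∣_) xs ⇔ Alternating b (betaNumbers xs)) (isEven-suc t) (rowsEven⇔alternating xs)

colLen-∷-< : ∀ {j x} xs → j < x → colLen (x ∷ xs) j ≡ suc (colLen xs j)
colLen-∷-< {j} xs j<x = cong length (filter-accept (j <?_) {xs = xs} j<x)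

colLen-∷-≮ : ∀ {j x} xs → ¬ j < x → colLen (x ∷ xs) j ≡ colLen xs j
colLen-∷-≮ {j} xs j≮x = cong length (filter-reject (j <?_) {xs = xs} j≮x)

colLen-beyond : ∀ {j xs} → All (_≤ j) xs → colLen xs j ≡ 0
colLen-beyond {j} xs≤j = cong length (filter-none (j <?_) (All.map ≤⇒≯ xs≤j))

2∣colLen-doubled⇔ : ∀ x r j → 2 ∣ colLen (x ∷ x ∷ r) j ⇔ 2 ∣ colLen r j
2∣colLen-doubled⇔ x r j with j <? x
... | yes j<x rewrite colLen-∷-< (x ∷ r) j<x | colLen-∷-< r j<x =
  mk⇔ (λ 2∣2+c → ∣m+n∣m⇒∣n 2∣2+c ∣-refl) (∣m∣n⇒∣m+n ∣-refl)
... | no j≮x rewrite colLen-∷-≮ (x ∷ r) j≮x | colLen-∷-≮ r j≮x = mk⇔ (λ p → p) (λ p → p)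

columnsEven⇔doubled : ∀ {P} → AllPairs _≥_ P → isEven (length P) ≡ true →
  (∀ j → 2 ∣ colLen P j) ⇔ Paired _≡_ P
columnsEven⇔doubled {[]}        _ _ = mk⇔ (λ _ → []) (λ _ _ → divides 0 refl)
columnsEven⇔doubled {x ∷ y ∷ r} ((y≤x ∷ _) ∷ r≤y ∷ r↓) even = mk⇔ to from
  where
  ih = columnsEven⇔doubled r↓ even
  to : (∀ j → 2 ∣ colLen (x ∷ y ∷ r) j) → Paired _≡_ (x ∷ y ∷ r)
  to cols with y <? x
  ... | yes y<x = contradiction (∣1⇒≡1 (subst (2 ∣_) column-y≡1 (cols y))) λ ()
    where
    column-y≡1 : colLen (x ∷ y ∷ r) y ≡ 1
    column-y≡1 = trans (colLen-∷-< (y ∷ r) y<x)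
                       (cong suc (trans (colLen-∷-≮ r (n≮n y)) (colLen-beyond r≤y)))
  ... | no y≮x with ≤-antisym (≮⇒≥ y≮x) y≤x
  ...   | refl = refl ∷ Equivalence.to ih (λ j → Equivalence.to (2∣colLen-doubled⇔ x r j) (cols j))
  from : Paired _≡_ (x ∷ y ∷ r) → ∀ j → 2 ∣ colLen (x ∷ y ∷ r) j
  from (refl ∷ doubled) j = Equivalence.from (2∣colLen-doubled⇔ x r j) (Equivalence.from ih doubled j)

doubled⇔paired-betaNumbers : ∀ P → Paired _≡_ P ⇔ Paired (λ x y → x ≡ suc y) (betaNumbers P)
doubled⇔paired-betaNumbers []          = mk⇔ (λ _ → []) (λ _ → [])
doubled⇔paired-betaNumbers (_ ∷ [])    = mk⇔ (λ ()) (λ ())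
doubled⇔paired-betaNumbers (x ∷ y ∷ r) = mk⇔
  (λ { (refl ∷ doubled) → +-suc x t ∷ Equivalence.to ih doubled })
  (λ { (x+1+t≡1+y+t ∷ paired) →
         +-cancelʳ-≡ t x y (suc-injective (trans (sym (+-suc x t)) x+1+t≡1+y+t)) ∷ Equivalence.from ih paired })
  where
  t : ℕ
  t = length r
  ih = doubled⇔paired-betaNumbers r

-- Chessboard colouring

length-≤-injective : ∀ {A B : Set} (f : A → B) {xs ys} → Unique xs → (∀ {x} → x ∈ xs → f x ∈ ys) →
  (∀ {x y} → x ∈ xs → y ∈ xs → f x ≡ f y → x ≡ y) → length xs ≤ length ys
length-≤-injective f {[]}     _                  _    _   = z≤n
length-≤-injective f {x ∷ xs} (x∉xs ∷ xs-unique) maps inj with ∈-∃++ (maps (here refl))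
... | ys₁ , ys₂ , refl = begin
  suc (length xs)                ≤⟨ s≤s (length-≤-injective f xs-unique maps′ (λ p q → inj (there p) (there q))) ⟩
  suc (length (ys₁ ++ ys₂))       ≡⟨ cong suc (length-++ ys₁) ⟩
  suc (length ys₁ + length ys₂)   ≡⟨ sym (+-suc (length ys₁) (length ys₂)) ⟩
  length ys₁ + suc (length ys₂)   ≡⟨ sym (length-++ ys₁) ⟩
  length (ys₁ ++ f x ∷ ys₂)       ∎
  where
  open ≤-Reasoning
  maps′ : ∀ {y} → y ∈ xs → f y ∈ ys₁ ++ ys₂
  maps′ y∈xs with ∈-++⁻ ys₁ (maps (there y∈xs))
  ... | inj₁ p         = ∈-++⁺ˡ p
  ... | inj₂ (here e)  = contradiction (sym (inj (there y∈xs) (here refl) e)) (All.lookup x∉xs y∈xs)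
  ... | inj₂ (there p) = ∈-++⁺ʳ ys₁ p

colour : Cell → Bool
colour (i , j) = isEven (i + j)

rowCells : Bool → ℕ → List Cell
rowCells b r = map (0 ,_) (filter (isEven≟ b) (downFrom r))

colouredCells : Bool → List ℕ → List Cell
colouredCells b []       = []
colouredCells b (r ∷ rs) = rowCells b r ++ map (map₁ suc) (colouredCells (not b) rs)

colour-below : ∀ i j → colour (suc i , j) ≡ not (colour (i , j))
colour-below i j = isEven-suc (i + j)

colour-right : ∀ i j → colour (i , suc j) ≡ not (colour (i , j))
colour-right i j = trans (cong isEven (+-suc i j)) (isEven-suc (i + j))

flip-not : ∀ {a b} → a ≡ not b → b ≡ not a
flip-not refl = sym (not-involutive _)

∈-colouredCells⁻ : ∀ b P {c} → c ∈ colouredCells b P → c ∈D P × colour c ≡ b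
∈-colouredCells⁻ b (r ∷ rs) c∈ with ∈-++⁻ (rowCells b r) c∈
... | inj₁ c∈row with ∈-map⁻ (0 ,_) c∈row
...   | j , j∈ , refl with ∈-filter⁻ (isEven≟ b) {xs = downFrom r} j∈
...     | j∈downFrom , colour≡b = ∈-downFrom⁻ j∈downFrom , colour≡b
∈-colouredCells⁻ b (r ∷ rs) c∈ | inj₂ c∈rest with ∈-map⁻ (map₁ suc) c∈rest
...   | (i , j) , c′∈ , refl with ∈-colouredCells⁻ (not b) rs c′∈
...     | j<rᵢ , colour≡¬b = j<rᵢ , trans (colour-below i j) (trans (cong not colour≡¬b) (not-involutive b))

∈-colouredCells⁺ : ∀ b P {c} → c ∈D P → colour c ≡ b → c ∈ colouredCells b P
∈-colouredCells⁺ b (r ∷ rs) {zero , j}  j<r  colour≡b =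
  ∈-++⁺ˡ (∈-map⁺ (0 ,_) (∈-filter⁺ (isEven≟ b) (∈-downFrom⁺ j<r) colour≡b))
∈-colouredCells⁺ b (r ∷ rs) {suc i , j} j<rᵢ colour≡b =
  ∈-++⁺ʳ (rowCells b r) (∈-map⁺ (map₁ suc) (∈-colouredCells⁺ (not b) rs j<rᵢ
    (trans (sym (not-involutive _)) (cong not (trans (sym (colour-below i j)) colour≡b)))))

colouredCells-unique : ∀ b P → Unique (colouredCells b P)
colouredCells-unique b []       = []
colouredCells-unique b (r ∷ rs) = Unique.++⁺
  (Unique.map⁺ (cong proj₂) (Unique.filter⁺ (isEven≟ b) (Unique.downFrom⁺ r)))
  (Unique.map⁺ (cong (map₁ pred)) (colouredCells-unique (not b) rs))
  disjoint
  where
  disjoint : ∀ {c} → ¬ (c ∈ rowCells b r × c ∈ map (map₁ suc) (colouredCells (not b) rs))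
  disjoint (c∈row , c∈rest) with ∈-map⁻ (0 ,_) c∈row | ∈-map⁻ (map₁ suc) c∈rest
  ... | _ , _ , refl | _ , _ , ()

adjacent-colour : ∀ c c′ → Adjacent c c′ → colour c′ ≡ not (colour c)
adjacent-colour (i , j) _       (inj₁ (refl , inj₁ refl)) = colour-right i j
adjacent-colour (i , _) (_ , j) (inj₁ (refl , inj₂ refl)) = flip-not (colour-right i j)
adjacent-colour (i , j) _       (inj₂ (refl , inj₁ refl)) = colour-below i j
adjacent-colour (_ , j) (i , _) (inj₂ (refl , inj₂ refl)) = flip-not (colour-below i j)

colour-balance : ∀ d → length (colouredCells true (shD d)) ≡ length (colouredCells false (shD d))
colour-balance d = ≤-antisym (partner≤ true) (partner≤ false)
  where
  P : List ℕ
  P = shD d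
  partner≤ : ∀ b → length (colouredCells b P) ≤ length (colouredCells (not b) P)
  partner≤ b = length-≤-injective (partner d) (colouredCells-unique b P) maps injective
    where
    inP : ∀ {c} → c ∈ colouredCells b P → c ∈D P
    inP = proj₁ ∘ ∈-colouredCells⁻ b P
    maps : ∀ {c} → c ∈ colouredCells b P → partner d c ∈ colouredCells (not b) P
    maps c∈ = ∈-colouredCells⁺ (not b) P (partner-in d _ (inP c∈))
      (trans (adjacent-colour _ _ (partner-adj d _ (inP c∈))) (cong not (proj₂ (∈-colouredCells⁻ b P c∈))))
    injective : ∀ {x y} → x ∈ colouredCells b P → y ∈ colouredCells b P → partner d x ≡ partner d y → x ≡ y
    injective {x} {y} x∈ y∈ same = begin
      x                       ≡⟨ sym (partner-inv d x (inP x∈)) ⟩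
      partner d (partner d x) ≡⟨ cong (partner d) same ⟩
      partner d (partner d y) ≡⟨ partner-inv d y (inP y∈) ⟩
      y                       ∎
      where open ≡-Reasoning

length-rowCells-true : ∀ r → length (rowCells true r) ≡ ⌈ r /2⌉
length-rowCells-true r = trans (length-map _ (filter (isEven≟ true) (downFrom r))) (evens r)
  where
  evens : ∀ r → length (filter (isEven≟ true) (downFrom r)) ≡ ⌈ r /2⌉
  evens zero          = refl
  evens (suc zero)    = refl
  evens (suc (suc r)) rewrite isEven-suc r with isEven r in parity
  ... | true  rewrite parity = cong suc (evens r)
  ... | false rewrite parity = cong suc (evens r)

length-rowCells-false : ∀ r → length (rowCells false r) ≡ ⌊ r /2⌋
length-rowCells-false r = trans (length-map _ (filter (isEven≟ false) (downFrom r))) (odds r)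
  where
  odds : ∀ r → length (filter (isEven≟ false) (downFrom r)) ≡ ⌊ r /2⌋
  odds zero          = refl
  odds (suc zero)    = refl
  odds (suc (suc r)) rewrite isEven-suc r with isEven r in parity
  ... | true  rewrite parity = cong suc (odds r)
  ... | false rewrite parity = cong suc (odds r)

length-colouredCells-∷ : ∀ b r rs →
  length (colouredCells b (r ∷ rs)) ≡ length (rowCells b r) + length (colouredCells (not b) rs)
length-colouredCells-∷ b r rs =
  trans (length-++ (rowCells b r))
        (cong (length (rowCells b r) +_) (length-map (map₁ suc) (colouredCells (not b) rs)))

oneIf : Bool → ℕ
oneIf b = if b then 1 else 0

oneIf-odd+⌊n/2⌋+⌊n/2⌋ : ∀ n → oneIf (not (isEven n)) + (⌊ n /2⌋ + ⌊ n /2⌋) ≡ n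
oneIf-odd+⌊n/2⌋+⌊n/2⌋ n with isEven n in parity
... | true  = even⇒⌊n/2⌋+⌊n/2⌋≡n n parity
... | false = odd⇒1+⌊n/2⌋+⌊n/2⌋≡n n parity

oneIf-even+⌈n/2⌉+⌈n/2⌉ : ∀ n → oneIf (isEven n) + (⌈ n /2⌉ + ⌈ n /2⌉) ≡ suc n
oneIf-even+⌈n/2⌉+⌈n/2⌉ n = trans
  (cong (λ b → oneIf b + (⌈ n /2⌉ + ⌈ n /2⌉)) (sym (trans (cong not (isEven-suc n)) (not-involutive _))))
  (oneIf-odd+⌊n/2⌋+⌊n/2⌋ (suc n))

length-evenHalves-∷ : ∀ x xs → length (evenHalves (x ∷ xs)) ≡ oneIf (isEven x) + length (evenHalves xs)
length-evenHalves-∷ x xs with isEven x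
... | true  = refl
... | false = refl

length-oddHalves-∷ : ∀ x xs → length (oddHalves (x ∷ xs)) ≡ oneIf (not (isEven x)) + length (oddHalves xs)
length-oddHalves-∷ x xs with isEven x
... | true  = refl
... | false = refl

isEven-+-even : ∀ m {n} → isEven n ≡ true → isEven (m + n) ≡ isEven m
isEven-+-even zero          even = even
isEven-+-even (suc zero)    {n} even = trans (isEven-suc n) (cong not even)
isEven-+-even (suc (suc m)) even = isEven-+-even m even

pair-interchange : ∀ a c e b d f → (a + (c + e)) + ((b + (d + f)) + (b + (d + f)))
                                 ≡ (a + (b + b)) + ((c + (d + d)) + (e + (f + f)))
pair-interchange = solve-∀

length-colouredCells-pair : ∀ x y rs →
  length (colouredCells true (x ∷ y ∷ rs)) ≡ ⌈ x /2⌉ + (⌊ y /2⌋ + length (colouredCells true rs)) ×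
  length (colouredCells false (x ∷ y ∷ rs)) ≡ ⌊ x /2⌋ + (⌈ y /2⌉ + length (colouredCells false rs))
length-colouredCells-pair x y rs =
  trans (length-colouredCells-∷ true x (y ∷ rs))
        (cong₂ _+_ (length-rowCells-true x)
                   (trans (length-colouredCells-∷ false y rs) (cong (_+ _) (length-rowCells-false y)))) ,
  trans (length-colouredCells-∷ false x (y ∷ rs))
        (cong₂ _+_ (length-rowCells-false x)
                   (trans (length-colouredCells-∷ true y rs) (cong (_+ _) (length-rowCells-true y))))

length-halves-betaNumbers-pair : ∀ x y rs → isEven (length rs) ≡ true →
  length (evenHalves (betaNumbers (x ∷ y ∷ rs)))
    ≡ oneIf (not (isEven x)) + (oneIf (isEven y) + length (evenHalves (betaNumbers rs))) ×
  length (oddHalves (betaNumbers (x ∷ y ∷ rs)))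
    ≡ oneIf (isEven x) + (oneIf (not (isEven y)) + length (oddHalves (betaNumbers rs)))
length-halves-betaNumbers-pair x y rs t-even =
  trans (length-evenHalves-∷ (x + suc t) (y + t ∷ βs))
        (cong₂ _+_ (cong oneIf parityˣ)
                   (trans (length-evenHalves-∷ (y + t) βs) (cong (λ b → oneIf b + _) parityʸ))) ,
  trans (length-oddHalves-∷ (x + suc t) (y + t ∷ βs))
        (cong₂ _+_ (cong oneIf (trans (cong not parityˣ) (not-involutive _)))
                   (trans (length-oddHalves-∷ (y + t) βs) (cong (λ b → oneIf (not b) + _) parityʸ)))
  where
  t : ℕ
  t = length rs
  βs : List ℕ
  βs = betaNumbers rs
  parityˣ : isEven (x + suc t) ≡ not (isEven x)
  parityˣ = trans (cong isEven (+-suc x t)) (trans (isEven-suc (x + t)) (cong not (isEven-+-even x t-even)))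
  parityʸ : isEven (y + t) ≡ isEven y
  parityʸ = isEven-+-even y t-even

evenBetas+2blacks≡oddBetas+2whites : ∀ P → isEven (length P) ≡ true →
  length (evenHalves (betaNumbers P)) + (length (colouredCells false P) + length (colouredCells false P))
  ≡ length (oddHalves (betaNumbers P)) + (length (colouredCells true P) + length (colouredCells true P))
evenBetas+2blacks≡oddBetas+2whites []           _      = refl
evenBetas+2blacks≡oddBetas+2whites (x ∷ y ∷ rs) t-even = begin
  E + (B + B)
    ≡⟨ cong₂ _+_ E≡ (cong₂ _+_ B≡ B≡) ⟩
  (oneIf (not ex) + (oneIf ey + E′)) + ((⌊ x /2⌋ + (⌈ y /2⌉ + B′)) + (⌊ x /2⌋ + (⌈ y /2⌉ + B′)))
    ≡⟨ pair-interchange (oneIf (not ex)) (oneIf ey) E′ ⌊ x /2⌋ ⌈ y /2⌉ B′ ⟩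
  (oneIf (not ex) + (⌊ x /2⌋ + ⌊ x /2⌋)) + ((oneIf ey + (⌈ y /2⌉ + ⌈ y /2⌉)) + (E′ + (B′ + B′)))
    ≡⟨ cong₂ _+_ (oneIf-odd+⌊n/2⌋+⌊n/2⌋ x) (cong₂ _+_ (oneIf-even+⌈n/2⌉+⌈n/2⌉ y) ih) ⟩
  x + (suc y + (O′ + (W′ + W′)))
    ≡⟨ +-suc x _ ⟩
  suc x + (y + (O′ + (W′ + W′)))
    ≡⟨ sym (cong₂ _+_ (oneIf-even+⌈n/2⌉+⌈n/2⌉ x) (cong (_+ (O′ + (W′ + W′))) (oneIf-odd+⌊n/2⌋+⌊n/2⌋ y))) ⟩
  (oneIf ex + (⌈ x /2⌉ + ⌈ x /2⌉)) + ((oneIf (not ey) + (⌊ y /2⌋ + ⌊ y /2⌋)) + (O′ + (W′ + W′)))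
    ≡⟨ sym (pair-interchange (oneIf ex) (oneIf (not ey)) O′ ⌈ x /2⌉ ⌊ y /2⌋ W′) ⟩
  (oneIf ex + (oneIf (not ey) + O′)) + ((⌈ x /2⌉ + (⌊ y /2⌋ + W′)) + (⌈ x /2⌉ + (⌊ y /2⌋ + W′)))
    ≡⟨ sym (cong₂ _+_ O≡ (cong₂ _+_ W≡ W≡)) ⟩
  O + (W + W) ∎
  where
  open ≡-Reasoning
  ex ey : Bool
  ex = isEven x
  ey = isEven y
  E O W B E′ O′ W′ B′ : ℕ
  E  = length (evenHalves (betaNumbers (x ∷ y ∷ rs)))
  O  = length (oddHalves (betaNumbers (x ∷ y ∷ rs)))
  W  = length (colouredCells true (x ∷ y ∷ rs))
  B  = length (colouredCells false (x ∷ y ∷ rs))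
  E′ = length (evenHalves (betaNumbers rs))
  O′ = length (oddHalves (betaNumbers rs))
  W′ = length (colouredCells true rs)
  B′ = length (colouredCells false rs)
  ih : E′ + (B′ + B′) ≡ O′ + (W′ + W′)
  ih = evenBetas+2blacks≡oddBetas+2whites rs t-even
  E≡ : E ≡ oneIf (not ex) + (oneIf ey + E′)
  E≡ = proj₁ (length-halves-betaNumbers-pair x y rs t-even)
  O≡ : O ≡ oneIf ex + (oneIf (not ey) + O′)
  O≡ = proj₂ (length-halves-betaNumbers-pair x y rs t-even)
  W≡ : W ≡ ⌈ x /2⌉ + (⌊ y /2⌋ + W′)
  W≡ = proj₁ (length-colouredCells-pair x y rs)
  B≡ : B ≡ ⌊ x /2⌋ + (⌈ y /2⌉ + B′)
  B≡ = proj₂ (length-colouredCells-pair x y rs)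

pad-elim : ∀ (Q : List ℕ → Set) la → Q la → Q (la ++ 0 ∷ []) → Q (pad la)
pad-elim Q la q q⁺ with isEven (length la)
... | true  = q
... | false = q⁺

pad-even : ∀ la → isEven (length (pad la)) ≡ true
pad-even la with isEven (length la) in parity
... | true  = parity
... | false = begin
  isEven (length (la ++ 0 ∷ [])) ≡⟨ cong isEven (length-++ la) ⟩
  isEven (length la + 1)          ≡⟨ cong isEven (+-comm (length la) 1) ⟩
  isEven (suc (length la))        ≡⟨ isEven-suc (length la) ⟩
  not (isEven (length la))        ≡⟨ cong not parity ⟩
  true                            ∎
  where open ≡-Reasoning

pad-decreasing : ∀ {la} → Linked _≥_ la → Linked _≥_ (pad la)
pad-decreasing {la} la↓ = pad-elim (Linked _≥_) la la↓ (snoc la↓)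
  where
  snoc : ∀ {xs} → Linked _≥_ xs → Linked _≥_ (xs ++ 0 ∷ [])
  snoc []         = [-]
  snoc [-]        = z≤n ∷ [-]
  snoc (x≥y ∷ ps) = x≥y ∷ snoc ps

pad-rows : ∀ la → All (2 ∣_) la ⇔ All (2 ∣_) (pad la)
pad-rows la = pad-elim (λ P → All (2 ∣_) la ⇔ All (2 ∣_) P) la (mk⇔ (λ p → p) (λ p → p))
  (mk⇔ (λ la-even → All.++⁺ la-even (divides 0 refl ∷ [])) (All.++⁻ˡ la))

pad-columnsEven : ∀ la → (∀ j → 2 ∣ colLen la j) ⇔ (∀ j → 2 ∣ colLen (pad la) j)
pad-columnsEven la =
  mk⇔ (λ even j → subst (2 ∣_) (sym (same j)) (even j)) (λ even j → subst (2 ∣_) (same j) (even j))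
  where
  snoc : ∀ j xs → colLen (xs ++ 0 ∷ []) j ≡ colLen xs j
  snoc j []       = colLen-∷-≮ {j} {0} [] λ ()
  snoc j (x ∷ xs) with j <? x
  ... | yes j<x = trans (colLen-∷-< (xs ++ 0 ∷ []) j<x) (trans (cong suc (snoc j xs)) (sym (colLen-∷-< xs j<x)))
  ... | no j≮x  = trans (colLen-∷-≮ (xs ++ 0 ∷ []) j≮x) (trans (snoc j xs) (sym (colLen-∷-≮ xs j≮x)))
  same : ∀ j → colLen (pad la) j ≡ colLen la j
  same j = pad-elim (λ P → colLen P j ≡ colLen la j) la refl (snoc j la)

pad-colouredCells : ∀ b la → colouredCells b (pad la) ≡ colouredCells b la
pad-colouredCells b la = pad-elim (λ P → colouredCells b P ≡ colouredCells b la) la refl (snoc b la)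
  where
  snoc : ∀ b xs → colouredCells b (xs ++ 0 ∷ []) ≡ colouredCells b xs
  snoc b []       = refl
  snoc b (x ∷ xs) = cong (λ cs → rowCells b x ++ map (map₁ suc) cs) (snoc (not b) xs)

⊆D⇒HorizontalStrip : ∀ μ ν → μ ⊆D ν → HorizontalStrip μ ν
⊆D⇒HorizontalStrip _ _ μ⊆ν i _ j c∈μ c∉ν _ _ = contradiction (μ⊆ν (i , j) c∈μ) c∉ν

⊆D⇒VerticalStrip : ∀ μ ν → μ ⊆D ν → VerticalStrip μ ν
⊆D⇒VerticalStrip _ _ μ⊆ν i j _ c∈μ c∉ν _ _ = contradiction (μ⊆ν (i , j) c∈μ) c∉ν

module TwoQuotient (d : DominoPP) where

  la P B E O : List ℕ
  la = shD d
  P  = pad la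
  B  = betaNumbers P
  E  = evenHalves B
  O  = oddHalves B

  P-decreasing : Linked _≥_ P
  P-decreasing = pad-decreasing (decreasing (shape d))

  B-strict : AllPairs _>_ B
  B-strict = Linked⇒AllPairs (λ x>y y>z → <-trans y>z x>y) (betaNumbers-strict P-decreasing)

  E-strict : AllPairs _>_ E
  E-strict = evenHalves-strict B-strict

  O-strict : AllPairs _>_ O
  O-strict = oddHalves-strict B-strict

  balanced : length E ≡ length O
  balanced = +-cancelʳ-≡ (blacks + blacks) (length E) (length O) (begin
    length E + (blacks + blacks) ≡⟨ evenBetas+2blacks≡oddBetas+2whites P (pad-even la) ⟩
    length O + (whites + whites) ≡⟨ cong (λ w → length O + (w + w)) whites≡blacks ⟩
    length O + (blacks + blacks) ∎)
    where
    open ≡-Reasoning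
    whites blacks : ℕ
    whites = length (colouredCells true P)
    blacks = length (colouredCells false P)
    whites≡blacks : whites ≡ blacks
    whites≡blacks = begin
      whites                              ≡⟨ cong length (pad-colouredCells true la) ⟩
      length (colouredCells true la)      ≡⟨ colour-balance d ⟩
      length (colouredCells false la)     ≡⟨ cong length (sym (pad-colouredCells false la)) ⟩
      blacks                              ∎

  rows⇔ : AllRowsEven d ⇔ ((quot0 la ⊆D quot1 la) × HorizontalStrip (quot1 la) (quot0 la))
  rows⇔ = begin
    All (2 ∣_) la
      ∼⟨ pad-rows la ⟩
    All (2 ∣_) P
      ∼⟨ rowsEven⇔alternating P ⟩
    Alternating (isEven (suc (length P))) B
      ≡⟨ cong (λ b → Alternating b B) (trans (isEven-suc (length P)) (cong not (pad-even la))) ⟩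
    Alternating false B
      ∼⟨ alternating⇔interlaced B-strict balanced ⟩
    Interlaced O E
      ∼⟨ ⇔-sym (fromBetas-interlaced⇔ O-strict E-strict (sym balanced)) ⟩
    ((∀ i → at (fromBetas E) i ≤ at (fromBetas O) i) × (∀ i → at (fromBetas O) (suc i) ≤ at (fromBetas E) i))
      ∼⟨ ⇔-sym (⊆D⇔at≤ (fromBetas E) (fromBetas O)
                ×-⇔ HorizontalStrip⇔ (fromBetas-antitone O-strict) (fromBetas-antitone E-strict)) ⟩
    ((fromBetas E ⊆D fromBetas O) × HorizontalStrip (fromBetas O) (fromBetas E))
      ≡⟨ cong₂ (λ q₀ q₁ → (q₀ ⊆D q₁) × HorizontalStrip q₁ q₀) (sym (quot0≡ la)) (sym (quot1≡ la)) ⟩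
    ((quot0 la ⊆D quot1 la) × HorizontalStrip (quot1 la) (quot0 la))
      ∎
    where open Related.EquationalReasoning

  columns⇔ : AllColsEven d ⇔ ((quot1 la ⊆D quot0 la) × VerticalStrip (quot0 la) (quot1 la))
  columns⇔ = begin
    (∀ j → 2 ∣ colLen la j)
      ∼⟨ pad-columnsEven la ⟩
    (∀ j → 2 ∣ colLen P j)
      ∼⟨ columnsEven⇔doubled (Linked⇒AllPairs (λ x≥y y≥z → ≤-trans y≥z x≥y) P-decreasing) (pad-even la) ⟩
    Paired _≡_ P
      ∼⟨ doubled⇔paired-betaNumbers P ⟩
    Paired (λ x y → x ≡ suc y) B
      ∼⟨ ⇔-sym (withinOne⇔paired B-strict) ⟩
    Pointwise WithinOne O E
      ∼⟨ ⇔-sym (fromBetas-withinOne⇔ O-strict E-strict (sym balanced)) ⟩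
    ((∀ i → at (fromBetas O) i ≤ at (fromBetas E) i) × (∀ i → at (fromBetas E) i ≤ suc (at (fromBetas O) i)))
      ∼⟨ ⇔-sym (⊆D⇔at≤ (fromBetas O) (fromBetas E) ×-⇔ VerticalStrip⇔ (fromBetas E) (fromBetas O)) ⟩
    ((fromBetas O ⊆D fromBetas E) × VerticalStrip (fromBetas E) (fromBetas O))
      ≡⟨ cong₂ (λ q₀ q₁ → (q₁ ⊆D q₀) × VerticalStrip q₀ q₁) (sym (quot0≡ la)) (sym (quot1≡ la)) ⟩
    ((quot1 la ⊆D quot0 la) × VerticalStrip (quot0 la) (quot1 la))
      ∎
    where open Related.EquationalReasoning

  rows×columns⇔ : (AllRowsEven d × AllColsEven d) ⇔ (quot0 la ≐D quot1 la)
  rows×columns⇔ = mk⇔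
    (λ (rows , columns) → proj₁ (Equivalence.to rows⇔ rows) , proj₁ (Equivalence.to columns⇔ columns))
    (λ (q₀⊆q₁ , q₁⊆q₀) → Equivalence.from rows⇔ (q₀⊆q₁ , ⊆D⇒HorizontalStrip (quot1 la) (quot0 la) q₁⊆q₀)
                       , Equivalence.from columns⇔ (q₁⊆q₀ , ⊆D⇒VerticalStrip (quot0 la) (quot1 la) q₀⊆q₁))

mainTheorem7 : (d : DominoPP) →
    (AllRowsEven d ⇔ ((sh (proj₁ (Φ d)) ⊆D sh (proj₂ (Φ d))) × HorizontalStrip (sh (proj₂ (Φ d))) (sh (proj₁ (Φ d)))))
    × (AllColsEven d ⇔ ((sh (proj₂ (Φ d)) ⊆D sh (proj₁ (Φ d))) × VerticalStrip (sh (proj₁ (Φ d))) (sh (proj₂ (Φ d)))))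
    × ((AllRowsEven d × AllColsEven d) ⇔ (sh (proj₁ (Φ d)) ≐D sh (proj₂ (Φ d))))
mainTheorem7 d = rows⇔ , columns⇔ , rows×columns⇔
  where open TwoQuotient d
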